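{- Let $\Delta_{n-1}$ be the $(n-1)$-simplex on an $n$-element vertex set $V$ and let $X\subseteq\Delta_{n-1}$ be a simplicial subcomplex. Then for $0\le k\le n-1$, $$h_k(X)=h^{n-k-2}(\Delta_{n-1},X^\vee),\qquad h^k(X)=h_{n-k-2}(\Delta_{n-1},X^\vee).$$
   Context: Coefficients are in $\mathbb{Z}_2$, and chain/cochain complexes are taken in the reduced setting (the empty simplex $\emptyset$ is the unique face of dimension $-1$, $\partial_0(v)=\emptyset$, $d_{ -1}(\emptyset^*)=\sum_v v^*$). The void complex has no faces. The Alexander dual is $X^\vee=\{\sigma\subseteq V:V\setminus\sigma\notin X\}$. For a pair $Y\subseteq X$, relative chains $C_k(X,Y)=C_k(X)/C_k(Y)$ are represented by chains supported on $X(k)\setminus Y(k)$ and relative cochains $C^k(X,Y)=C^k(X)/C^k(Y)$ (with $C^k(Y)$ the cochains supported on $Y$) by cochains supported on $X(k)\setminus Y(k)$; the norm $\|\cdot\|$ is the size of the support of this representative. $\|c\|_{sys}=\min_{c'}\|c+\partial_{k+1}c'\|$, $\|\phi\|_{csy}=\min_\psi\|\phi+d_{k-1}\psi\|$, $h_k(X,Y)=\min\{\|\partial_kc\|/\|c\|_{sys}:c\in C_k(X,Y)\setminus B_k(X,Y)\}$, $h^k(X,Y)=\min\{\|d_k\phi\|/\|\phi\|_{csy}:\phi\in C^k(X,Y)\setminus B^k(X,Y)\}$, where $B$ denotes (co)boundaries. Absolute versions are $h_k(X)=h_k(X,\text{void})$, $h^k(X)=h^k(X,\text{void})$. -}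

module Defs where

open import Data.Bool using (Bool; true; false; not; _∧_; _xor_; if_then_else_)
open import Data.Nat using (ℕ; zero; suc; _+_; _≤_)
open import Data.Integer as ℤ using (ℤ; +_; _-_)
open import Data.Fin using (Fin; zero; suc)
open import Data.Fin.Subset using (Subset; ∣_∣; _⊆_; ∁)
open import Data.Vec using (Vec; []; _∷_; lookup; _[_]≔_)
open import Data.Rational as ℚ using (ℚ; 0ℚ)
open import Data.Maybe using (Maybe; just; nothing)
open import Data.Product using (Σ; ∃; _×_; _,_)
open import Relation.Nullary using (¬_; does)
open import Relation.Binary.PropositionalEquality using (_≡_; _≗_)

-- Vertex set V = Fin n, faces = subsets of V (Subset n = Vec Bool n).  The void complex is λ _ → false; the full simplex Δ_{n-1}
-- is λ _ → true (it contains ∅).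

FaceSet : ℕ → Set
FaceSet n = Subset n → Bool

IsComplex : ∀ {n} → FaceSet n → Set
IsComplex X = ∀ σ τ → τ ⊆ σ → X σ ≡ true → X τ ≡ true

void : ∀ {n} → FaceSet n
void _ = false

Δ : ∀ {n} → FaceSet n
Δ _ = true

dual : ∀ {n} → FaceSet n → FaceSet n
dual X σ = not (X (∁ σ))

-- dimension of a face: |σ| - 1  (∅ has dimension -1)
dim : ∀ {n} → Subset n → ℤ
dim σ = + ∣ σ ∣ - + 1

relFace : ∀ {n} → FaceSet n → FaceSet n → ℤ → Subset n → Bool
relFace X Y k σ = X σ ∧ not (Y σ) ∧ does (dim σ ℤ.≟ k)

xorSum : ∀ {n} → (Fin n → Bool) → Bool
xorSum {zero}  f = false
xorSum {suc n} f = f zero xor xorSum (λ i → f (suc i))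

countS : ∀ {n} → (Subset n → Bool) → ℕ
countS {zero}  f = if f [] then 1 else 0
countS {suc n} f = countS (λ s → f (false ∷ s)) + countS (λ s → f (true ∷ s))

-- (Co)chains over ℤ₂ are functions Subset n → Bool.  A relative k-(co)chain
-- of (X,Y) is represented by a (co)chain supported on X(k) ∖ Y(k).

Chain : ℕ → Set
Chain n = Subset n → Bool

RelChain : ∀ {n} → FaceSet n → FaceSet n → ℤ → Chain n → Set
RelChain X Y k c = ∀ σ → c σ ≡ true → relFace X Y k σ ≡ true

_⊕_ : ∀ {n} → Chain n → Chain n → Chain n
(c ⊕ c') σ = c σ xor c' σ

norm : ∀ {n} → Chain n → ℕ
norm c = countS c

∂ : ∀ {n} → FaceSet n → FaceSet n → ℤ → Chain n → Chain n
∂ X Y k c τ = relFace X Y (k - + 1) τ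
  ∧ xorSum (λ v → not (lookup τ v) ∧ c (τ [ v ]≔ true))

d : ∀ {n} → FaceSet n → FaceSet n → ℤ → Chain n → Chain n
d X Y k φ σ = relFace X Y (k ℤ.+ + 1) σ
  ∧ xorSum (λ v → lookup σ v ∧ φ (σ [ v ]≔ false))

IsBoundary : ∀ {n} → FaceSet n → FaceSet n → ℤ → Chain n → Set
IsBoundary X Y k c =
  ∃ λ c' → RelChain X Y (k ℤ.+ + 1) c' × ∂ X Y (k ℤ.+ + 1) c' ≗ c

IsCoboundary : ∀ {n} → FaceSet n → FaceSet n → ℤ → Chain n → Set
IsCoboundary X Y k φ =
  ∃ λ ψ → RelChain X Y (k - + 1) ψ × d X Y (k - + 1) ψ ≗ φ

SysNorm : ∀ {n} → FaceSet n → FaceSet n → ℤ → Chain n → ℕ → Set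
SysNorm X Y k c s =
  (∃ λ c' → RelChain X Y (k ℤ.+ + 1) c' × norm (c ⊕ ∂ X Y (k ℤ.+ + 1) c') ≡ s)
  × (∀ c' → RelChain X Y (k ℤ.+ + 1) c' → s ≤ norm (c ⊕ ∂ X Y (k ℤ.+ + 1) c'))

CosysNorm : ∀ {n} → FaceSet n → FaceSet n → ℤ → Chain n → ℕ → Set
CosysNorm X Y k φ s =
  (∃ λ ψ → RelChain X Y (k - + 1) ψ × norm (φ ⊕ d X Y (k - + 1) ψ) ≡ s)
  × (∀ ψ → RelChain X Y (k - + 1) ψ → s ≤ norm (φ ⊕ d X Y (k - + 1) ψ))

-- a / b as a rational (only used with b ≥ 1; b = 0 ↦ 0 is a dummy case)
ratio : ℕ → ℕ → ℚ
ratio a zero    = 0ℚ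
ratio a (suc b) = (+ a) ℚ./ suc b

HomRatio : ∀ {n} → FaceSet n → FaceSet n → ℤ → ℚ → Set
HomRatio X Y k r = ∃ λ c → RelChain X Y k c × ¬ IsBoundary X Y k c
  × ∃ λ s → SysNorm X Y k c s × r ≡ ratio (norm (∂ X Y k c)) s

CohomRatio : ∀ {n} → FaceSet n → FaceSet n → ℤ → ℚ → Set
CohomRatio X Y k r = ∃ λ φ → RelChain X Y k φ × ¬ IsCoboundary X Y k φ
  × ∃ λ s → CosysNorm X Y k φ s × r ≡ ratio (norm (d X Y k φ)) s

-- "min R = v", with values in ℚ ∪ {∞}: nothing = ∞ = min of the empty set
IsMin : (ℚ → Set) → Maybe ℚ → Set
IsMin R nothing  = ∀ r → ¬ R r
IsMin R (just r) = R r × (∀ r' → R r' → r ℚ.≤ r')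

HomExp : ∀ {n} → FaceSet n → FaceSet n → ℤ → Maybe ℚ → Set
HomExp X Y k = IsMin (HomRatio X Y k)

CohomExp : ∀ {n} → FaceSet n → FaceSet n → ℤ → Maybe ℚ → Set
CohomExp X Y k = IsMin (CohomRatio X Y k)

module Submission where

-- Complementation σ ↦ V ∖ σ is an involution on faces.  It sends a
-- face of dimension k to one of dimension n-k-2, it sends the k-faces of X
-- bijectively onto the (n-k-2)-faces of Δ that are not in X^∨ (the support of
-- relative (co)chains of (Δ,X^∨)), and it turns "add a vertex v ∉ τ" into
-- "remove a vertex v ∈ ∁τ".  Hence precomposition with complementation,
-- T c = c ∘ ∁, is a support-size preserving bijection
--   C_k(X) ≅ C^{n-k-2}(Δ,X^∨) with d ∘ T = T ∘ ∂,  and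
--   C^k(X) ≅ C_{n-k-2}(Δ,X^∨) with ∂ ∘ T = T ∘ d.
-- Such a bijection carries non-(co)boundaries to non-(co)boundaries, systolic
-- norms to cosystolic norms and ‖∂c‖ to ‖dTc‖, so the two sets of expansion
-- ratios coincide and therefore so do their minima.

open import Defs
open import Data.Nat using (ℕ; _<_)
open import Data.Integer using (+_; _-_)
open import Data.Rational using (ℚ)
open import Data.Maybe using (Maybe)
open import Data.Product using (_×_)
open import Function.Bundles using (_⇔_)

open import Data.Nat using (_≤_)
open import Algebra.Bundles using (AbelianGroup)
open import Data.Bool using (Bool; true; false; not; _∧_; _xor_)
open import Data.Bool.Properties using (not-involutive)
open import Data.Fin using (Fin; zero; suc)
open import Data.Fin.Subset using (Subset; ∣_∣; ∁)
open import Data.Fin.Subset.Properties using (∣∁p∣≡n∸∣p∣; ∣p∣≤n)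
open import Data.Integer as ℤ using (ℤ)
import Data.Integer.Properties as ℤP
open import Data.Integer.Tactic.RingSolver using (solve-∀)
open import Data.Maybe using (just; nothing)
import Data.Nat as ℕ
import Data.Nat.Properties as ℕP
open import Data.Product using (∃; _,_)
open import Data.Vec using ([]; _∷_; map; lookup; _[_]≔_)
open import Data.Vec.Properties using (map-∘; map-cong; map-id; lookup-map; map-[]≔)
open import Function.Bundles using (mk⇔; Equivalence)
open import Relation.Nullary using (¬_)
open import Relation.Nullary.Decidable using (does-⇔)
open import Relation.Binary.PropositionalEquality

open import Algebra.Properties.Group (AbelianGroup.group ℤP.+-0-abelianGroup)
  using (∙-cancelˡ)

∁-involutive : ∀ {n} (σ : Subset n) → ∁ (∁ σ) ≡ σ
∁-involutive σ = begin
  ∁ (∁ σ)                   ≡⟨ map-∘ not not σ ⟨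
  map (λ b → not (not b)) σ ≡⟨ map-cong not-involutive σ ⟩
  map (λ b → b) σ           ≡⟨ map-id σ ⟩
  σ                         ∎
  where open ≡-Reasoning

T : ∀ {n} → Chain n → Chain n
T c σ = c (∁ σ)

T-involutive : ∀ {n} (c : Chain n) → T (T c) ≗ c
T-involutive c σ = cong c (∁-involutive σ)

countS-cong : ∀ {n} {f g : Subset n → Bool} → f ≗ g → countS f ≡ countS g
countS-cong {ℕ.zero} f≗g rewrite f≗g [] = refl
countS-cong {ℕ.suc n} f≗g = cong₂ ℕ._+_
  (countS-cong (λ s → f≗g (false ∷ s))) (countS-cong (λ s → f≗g (true ∷ s)))

xorSum-cong : ∀ {n} {f g : Fin n → Bool} → f ≗ g → xorSum f ≡ xorSum g
xorSum-cong {ℕ.zero} f≗g = refl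
xorSum-cong {ℕ.suc n} f≗g = cong₂ _xor_ (f≗g zero) (xorSum-cong (λ i → f≗g (suc i)))

⊕-cong : ∀ {n} {a a' b b' : Chain n} → a ≗ a' → b ≗ b' → (a ⊕ b) ≗ (a' ⊕ b')
⊕-cong a≗a' b≗b' σ = cong₂ _xor_ (a≗a' σ) (b≗b' σ)

-- T preserves the size of the support: on the first vertex, ∁ swaps the
-- subsets omitting it with those containing it (induction on n).
countS-T : ∀ {n} (f : Subset n → Bool) → countS (T f) ≡ countS f
countS-T {ℕ.zero} f = refl
countS-T {ℕ.suc n} f = trans
  (cong₂ ℕ._+_ (countS-T (λ s → f (true ∷ s))) (countS-T (λ s → f (false ∷ s))))
  (ℕP.+-comm (countS (λ s → f (true ∷ s))) _)

-- The degree n - 2 in which the dimensions of complementary faces sum.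
dualDegree : ℕ → ℤ
dualDegree n = + n - + 2

-- dim σ + dim (V ∖ σ) = (|σ| - 1) + (n - |σ| - 1) = n - 2.
dim-complement : ∀ {n} (σ : Subset n) → dim σ ℤ.+ dim (∁ σ) ≡ dualDegree n
dim-complement {n} σ = begin
  (+ ∣ σ ∣ - + 1) ℤ.+ (+ ∣ ∁ σ ∣ - + 1) ≡⟨ regroup (+ ∣ σ ∣) (+ ∣ ∁ σ ∣) ⟩
  (+ ∣ σ ∣ ℤ.+ + ∣ ∁ σ ∣) - + 2         ≡⟨ cong (_- + 2) (ℤP.pos-+ ∣ σ ∣ ∣ ∁ σ ∣) ⟨
  + (∣ σ ∣ ℕ.+ ∣ ∁ σ ∣) - + 2           ≡⟨ cong (λ m → + m - + 2) sizes ⟩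
  dualDegree n ∎
  where
  open ≡-Reasoning
  regroup : ∀ x y → (x - + 1) ℤ.+ (y - + 1) ≡ (x ℤ.+ y) - + 2
  regroup = solve-∀
  sizes : ∣ σ ∣ ℕ.+ ∣ ∁ σ ∣ ≡ n
  sizes = trans (cong (∣ σ ∣ ℕ.+_) (∣∁p∣≡n∸∣p∣ σ)) (ℕP.m+[n∸m]≡n (∣p∣≤n σ))

other-summand : ∀ {x y a b s : ℤ} → x ℤ.+ y ≡ s → a ℤ.+ b ≡ s → x ≡ a → y ≡ b
other-summand {x} {y} {b = b} x+y a+b refl = ∙-cancelˡ x y b (trans x+y (sym a+b))

dim-complement-⇔ : ∀ {n} (σ : Subset n) a b → a ℤ.+ b ≡ dualDegree n →
  (dim σ ≡ a) ⇔ (dim (∁ σ) ≡ b)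
dim-complement-⇔ σ a b a+b = mk⇔
  (other-summand (dim-complement σ) a+b)
  (other-summand (trans (ℤP.+-comm (dim (∁ σ)) (dim σ)) (dim-complement σ))
                 (trans (ℤP.+-comm b a) a+b))

pred+suc : ∀ k j → (k - + 1) ℤ.+ (j ℤ.+ + 1) ≡ k ℤ.+ j
pred+suc = solve-∀

suc+pred : ∀ k j → (k ℤ.+ + 1) ℤ.+ (j - + 1) ≡ k ℤ.+ j
suc+pred = solve-∀

face-complement : ∀ {n} (X : FaceSet n) a b → a ℤ.+ b ≡ dualDegree n → ∀ σ →
  relFace X void a σ ≡ relFace Δ (dual X) b (∁ σ)
face-complement X a b a+b σ rewrite ∁-involutive σ | not-involutive (X σ) =
  cong (X σ ∧_) (does-⇔ (dim-complement-⇔ σ a b a+b) (dim σ ℤ.≟ a) (dim (∁ σ) ℤ.≟ b))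

face-complement′ : ∀ {n} (X : FaceSet n) a b → a ℤ.+ b ≡ dualDegree n → ∀ σ →
  relFace Δ (dual X) b σ ≡ relFace X void a (∁ σ)
face-complement′ X a b a+b σ =
  sym (trans (face-complement X a b a+b (∁ σ)) (cong (relFace Δ (dual X) b) (∁-involutive σ)))

-- Adding a vertex v ∉ τ to τ is removing v ∈ ∁τ from ∁τ, so d ∘ T = T ∘ ∂.
d-T : ∀ {n} (X : FaceSet n) k j → k ℤ.+ j ≡ dualDegree n → ∀ c →
  d Δ (dual X) j (T c) ≗ T (∂ X void k c)
d-T X k j k+j c σ = cong₂ _∧_
  (face-complement′ X (k - + 1) (j ℤ.+ + 1) (trans (pred+suc k j) k+j) σ)
  (xorSum-cong λ v → cong₂ _∧_
    (sym (trans (cong not (lookup-map v not σ)) (not-involutive _)))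
    (cong c (map-[]≔ not σ v)))

-- Removing a vertex v ∈ σ from σ is adding v ∉ ∁σ to ∁σ, so ∂ ∘ T = T ∘ d.
∂-T : ∀ {n} (X : FaceSet n) k j → k ℤ.+ j ≡ dualDegree n → ∀ c →
  ∂ Δ (dual X) j (T c) ≗ T (d X void k c)
∂-T X k j k+j c σ = cong₂ _∧_
  (face-complement′ X (k ℤ.+ + 1) (j - + 1) (trans (suc+pred k j) k+j) σ)
  (xorSum-cong λ v → cong₂ _∧_
    (sym (lookup-map v not σ))
    (cong c (map-[]≔ not σ v)))

-- An expansion problem: for each degree k, the (co)chains of degree k, the
-- (co)boundary map out of degree k, and the degree `source k` whose map
-- lands in degree k.  Homology and cohomology of a pair are instances.
record Expansion (n : ℕ) : Set₁ where
  field
    Supp    : ℤ → Chain n → Set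
    op      : ℤ → Chain n → Chain n
    source  : ℤ → ℤ
    op-cong : ∀ k {c c' : Chain n} → c ≗ c' → op k c ≗ op k c'

module _ {n : ℕ} (E : Expansion n) where
  open Expansion E

  IsImage : ℤ → Chain n → Set
  IsImage k c = ∃ λ c' → Supp (source k) c' × op (source k) c' ≗ c

  IsFillingNorm : ℤ → Chain n → ℕ → Set
  IsFillingNorm k c m =
    (∃ λ c' → Supp (source k) c' × norm (c ⊕ op (source k) c') ≡ m)
    × (∀ c' → Supp (source k) c' → m ≤ norm (c ⊕ op (source k) c'))

  IsRatio : ℤ → ℚ → Set
  IsRatio k r = ∃ λ c → Supp k c × ¬ IsImage k c
    × ∃ λ m → IsFillingNorm k c m × r ≡ ratio (norm (op k c)) m

∂-cong : ∀ {n} (X Y : FaceSet n) k {c c' : Chain n} → c ≗ c' → ∂ X Y k c ≗ ∂ X Y k c'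
∂-cong X Y k c≗c' τ =
  cong (relFace X Y (k - + 1) τ ∧_) (xorSum-cong λ v → cong (not (lookup τ v) ∧_) (c≗c' _))

d-cong : ∀ {n} (X Y : FaceSet n) k {c c' : Chain n} → c ≗ c' → d X Y k c ≗ d X Y k c'
d-cong X Y k c≗c' σ =
  cong (relFace X Y (k ℤ.+ + 1) σ ∧_) (xorSum-cong λ v → cong (lookup σ v ∧_) (c≗c' _))

-- The two instances: IsRatio (homology X Y) k and IsRatio (cohomology X Y) k
-- unfold to HomRatio X Y k and CohomRatio X Y k respectively.
homology : ∀ {n} → FaceSet n → FaceSet n → Expansion n
homology X Y = record
  { Supp = RelChain X Y ; op = ∂ X Y ; source = λ k → k ℤ.+ + 1 ; op-cong = ∂-cong X Y }

cohomology : ∀ {n} → FaceSet n → FaceSet n → Expansion n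
cohomology X Y = record
  { Supp = RelChain X Y ; op = d X Y ; source = λ k → k - + 1 ; op-cong = d-cong X Y }

record Duality {n : ℕ} (A B : Expansion n) : Set₁ where
  open Expansion
  field
    Paired        : ℤ → ℤ → Set
    paired-source : ∀ {k j} → Paired k j → Paired (source A k) (source B j)
    supp-to       : ∀ {k j c} → Paired k j → Supp A k c → Supp B j (T c)
    supp-from     : ∀ {k j c} → Paired k j → Supp B j c → Supp A k (T c)
    intertwine    : ∀ {k j} → Paired k j → ∀ c → op B j (T c) ≗ T (op A k c)

module Transport {n : ℕ} {A B : Expansion n} (D : Duality A B) where
  open Duality D
  open Expansion

  -- Since T is an involution, the intertwining law also holds backwards.
  intertwine⁻¹ : ∀ {k j} → Paired k j → ∀ ψ → op A k (T ψ) ≗ T (op B j ψ)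
  intertwine⁻¹ {k} {j} p ψ σ = begin
    op A k (T ψ) σ             ≡⟨ T-involutive (op A k (T ψ)) σ ⟨
    T (T (op A k (T ψ))) σ     ≡⟨ intertwine p (T ψ) (∁ σ) ⟨
    op B j (T (T ψ)) (∁ σ)     ≡⟨ op-cong B j (T-involutive ψ) (∁ σ) ⟩
    T (op B j ψ) σ ∎
    where open ≡-Reasoning

  image-from : ∀ {k j c} → Paired k j → IsImage B j (T c) → IsImage A k c
  image-from {c = c} p (ψ , suppψ , opψ≗Tc) =
    T ψ , supp-from (paired-source p) suppψ ,
    λ σ → trans (intertwine⁻¹ (paired-source p) ψ σ) (trans (opψ≗Tc (∁ σ)) (T-involutive c σ))

  norm-op : ∀ {k j} → Paired k j → ∀ c → norm (op B j (T c)) ≡ norm (op A k c)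
  norm-op {k} p c = trans (countS-cong (intertwine p c)) (countS-T (op A k c))

  fillingNorm-to : ∀ {k j c m} → Paired k j →
    IsFillingNorm A k c m → IsFillingNorm B j (T c) m
  fillingNorm-to {k} {j} {c} {m} p ((c' , suppc' , attained) , minimal) =
    (T c' , supp-to p′ suppc' , trans (normSum c') attained) ,
    λ ψ suppψ → ℕP.≤-trans (minimal (T ψ) (supp-from p′ suppψ))
      (ℕP.≤-reflexive (trans (countS-cong (⊕-cong (λ σ → sym (T-involutive c σ))
        (intertwine⁻¹ p′ ψ))) (countS-T (T c ⊕ op B (source B j) ψ))))
    where
    p′ = paired-source p
    normSum : ∀ c' → norm (T c ⊕ op B (source B j) (T c')) ≡ norm (c ⊕ op A (source A k) c')
    normSum c' = trans (countS-cong (⊕-cong {a = T c} (λ _ → refl) (intertwine p′ c')))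
      (countS-T (c ⊕ op A (source A k) c'))

  ratio-to : ∀ {k j r} → Paired k j → IsRatio A k r → IsRatio B j r
  ratio-to p (c , suppc , notImage , m , fill , r≡) =
    T c , supp-to p suppc , (λ im → notImage (image-from {c = c} p im)) ,
    m , fillingNorm-to {c = c} p fill , trans r≡ (cong (λ x → ratio x m) (sym (norm-op p c)))

-- A duality can be read backwards (T is an involution).
Duality-sym : ∀ {n} {A B : Expansion n} → Duality A B → Duality B A
Duality-sym D = record
  { Paired = λ j k → Paired k j ; paired-source = paired-source
  ; supp-to = supp-from ; supp-from = supp-to ; intertwine = Transport.intertwine⁻¹ D }
  where open Duality D

ratio-⇔ : ∀ {n} {A B : Expansion n} (D : Duality A B) → ∀ {k j} → Duality.Paired D k j →
  ∀ r → IsRatio A k r ⇔ IsRatio B j r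
ratio-⇔ D p r = mk⇔ (Transport.ratio-to D p) (Transport.ratio-to (Duality-sym D) p)

isMin-⇔ : (P Q : ℚ → Set) → (∀ r → P r ⇔ Q r) → ∀ v → IsMin P v ⇔ IsMin Q v
isMin-⇔ P Q P⇔Q nothing = mk⇔
  (λ noP r q → noP r (Equivalence.from (P⇔Q r) q))
  (λ noQ r p → noQ r (Equivalence.to (P⇔Q r) p))
isMin-⇔ P Q P⇔Q (just x) = mk⇔
  (λ (px , least) → Equivalence.to (P⇔Q x) px , λ r q → least r (Equivalence.from (P⇔Q r) q))
  (λ (qx , least) → Equivalence.from (P⇔Q x) qx , λ r p → least r (Equivalence.to (P⇔Q r) p))

supp-to-dual : ∀ {n} (X : FaceSet n) {k j c} → k ℤ.+ j ≡ dualDegree n →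
  RelChain X void k c → RelChain Δ (dual X) j (T c)
supp-to-dual X {k} {j} k+j suppc σ cσ = trans (face-complement′ X k j k+j σ) (suppc (∁ σ) cσ)

supp-from-dual : ∀ {n} (X : FaceSet n) {k j c} → k ℤ.+ j ≡ dualDegree n →
  RelChain Δ (dual X) j c → RelChain X void k (T c)
supp-from-dual X {k} {j} k+j suppc σ cσ = trans (face-complement X k j k+j σ) (suppc (∁ σ) cσ)

homology-cohomology : ∀ {n} (X : FaceSet n) → Duality (homology X void) (cohomology Δ (dual X))
homology-cohomology {n} X = record
  { Paired = λ k j → k ℤ.+ j ≡ dualDegree n
  ; paired-source = λ {k} {j} k+j → trans (suc+pred k j) k+j
  ; supp-to = supp-to-dual X
  ; supp-from = supp-from-dual X
  ; intertwine = λ {k} {j} → d-T X k j }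

cohomology-homology : ∀ {n} (X : FaceSet n) → Duality (cohomology X void) (homology Δ (dual X))
cohomology-homology {n} X = record
  { Paired = λ k j → k ℤ.+ j ≡ dualDegree n
  ; paired-source = λ {k} {j} k+j → trans (pred+suc k j) k+j
  ; supp-to = supp-to-dual X
  ; supp-from = supp-from-dual X
  ; intertwine = λ {k} {j} → ∂-T X k j }

complementary : ∀ n k → + k ℤ.+ (+ n - + k - + 2) ≡ dualDegree n
complementary n k = cancel (+ k) (+ n)
  where
  cancel : ∀ x y → x ℤ.+ (y - x - + 2) ≡ y - + 2
  cancel = solve-∀

corollary2p9 : (n : ℕ) (X : FaceSet n) → IsComplex X → (k : ℕ) → k < n →
    (∀ (v : Maybe ℚ) → HomExp X void (+ k) v ⇔ CohomExp Δ (dual X) (+ n - + k - + 2) v)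
    × (∀ (v : Maybe ℚ) → CohomExp X void (+ k) v ⇔ HomExp Δ (dual X) (+ n - + k - + 2) v)
corollary2p9 n X _ k _ =
  isMin-⇔ _ _ (ratio-⇔ (homology-cohomology X) (complementary n k)) ,
  isMin-⇔ _ _ (ratio-⇔ (cohomology-homology X) (complementary n k))
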